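{- Every rooted tree has a main stem.
   Context: A rooted tree is a tree $T$ with a distinguished vertex $r(T)$, the root. For an edge $e$ of $T$, the forest $T-e$ has two components; the $e$-branch $B_e$ is the component not containing $r(T)$. If $T$ has $m$ edges, a main stem of $T$ is a path $P$ starting at $r(T)$ such that for every edge $e\notin E(P)$, the $e$-branch satisfies $|E(B_e)|<\lfloor m/2\rfloor$. -}

module Defs where

open import Data.Nat using (ℕ; zero; suc; _+_; _<_)
open import Data.Nat.DivMod using (_/_)
open import Data.List using (List; []; _∷_; length; lookup)
open import Data.Fin using (Fin; _≟_)
open import Data.Empty using (⊥)
open import Data.Product using (Σ)
open import Relation.Nullary using (¬_; yes; no)
open import Relation.Binary.PropositionalEquality using (_≡_; refl)

data Tree : Set where
  node : List Tree → Tree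

children : Tree → List Tree
children (node ts) = ts

mutual
  edges : Tree → ℕ
  edges (node ts) = edgesL ts

  edgesL : List Tree → ℕ
  edgesL []       = 0
  edgesL (t ∷ ts) = suc (edges t + edgesL ts)

-- An edge of a tree, identified by the (non-root) vertex it leads to:
-- either an edge from the root to its i-th child, or an edge inside the
-- subtree of the i-th child.
data Edge : Tree → Set where
  here  : ∀ {ts} (i : Fin (length ts)) → Edge (node ts)
  there : ∀ {ts} (i : Fin (length ts)) → Edge (lookup ts i) → Edge (node ts)

-- The e-branch B_e: the component of T - e not containing the root,
-- i.e. the subtree hanging below e.
branch : ∀ {t} → Edge t → Tree
branch {node ts} (here i)    = lookup ts i
branch {node ts} (there i e) = branch e

-- A path in T starting at the root r(T).  In a tree every such path
-- goes downwards: it either stops, or uses the edge to some child i and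
-- continues as a path starting at that child.
data Path : Tree → Set where
  stop : ∀ {t} → Path t
  down : ∀ {ts} (i : Fin (length ts)) → Path (lookup ts i) → Path (node ts)

InPath : ∀ {t} → Path t → Edge t → Set
InPath stop         e           = ⊥
InPath (down i p)   (here j)    = i ≡ j
InPath (down i p)   (there j e) with i ≟ j
... | yes refl = InPath p e
... | no  _    = ⊥

IsMainStem : (t : Tree) → Path t → Set
IsMainStem t P = (e : Edge t) → ¬ InPath P e → edges (branch e) < edges t / 2

MainStem : Tree → Set
MainStem t = Σ (Path t) (IsMainStem t)

-- Follow the heavy path: from the root, always descend to a child whose
-- subtree has the most edges.  If an edge e leaves this path at a vertex v,
-- the path itself continues from v into a sibling subtree at least as large
-- as B_e; the two subtrees and their two edges are disjoint, so
-- 2 |E(B_e)| + 2 ≤ m, i.e. |E(B_e)| < ⌊m/2⌋.  Edges further down off the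
-- path have even smaller branches.
module Submission where

open import Defs
open import Data.Nat using (ℕ; suc; _+_; _*_; _≤_; _<_; s≤s)
open import Data.Nat.Properties
  using (≤-refl; ≤-trans; <⇒≤; ≤-<-trans; m≤m+n; m≤n+m; m≤n⇒m≤1+n; +-suc; +-comm;
         +-identityʳ; *-comm; +-monoʳ-≤; _≤?_; ≰⇒>)
open import Data.Nat.DivMod using (_/_; m*n/n≡m; /-monoˡ-≤)
open import Data.List using (List; []; _∷_; length; lookup)
open import Data.Fin using (Fin; zero; suc; _≟_)
open import Data.Product using (_,_)
open import Data.Empty using (⊥-elim)
open import Function using (_∘_)
open import Relation.Nullary using (¬_; yes; no)
open import Relation.Binary.PropositionalEquality using (_≡_; _≢_; refl; sym; cong; subst)

smaller<half : ∀ {x y m} → x ≤ y → suc (suc (x + y)) ≤ m → x < m / 2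
smaller<half {x} {y} {m} x≤y le =
  subst (_≤ m / 2) (m*n/n≡m (suc x) 2) (/-monoˡ-≤ 2 (subst (_≤ m) double le′))
  where
  le′ : suc (suc (x + x)) ≤ m
  le′ = ≤-trans (s≤s (s≤s (+-monoʳ-≤ x x≤y))) le
  -- 2 * x unfolds to x + (x + 0)
  double : suc (suc (x + x)) ≡ suc x * 2
  double = cong (λ k → 2 + k) (subst (λ k → x + k ≡ x * 2) (+-identityʳ x) (*-comm 2 x))

edgesL-tail : ∀ t ts → edgesL ts ≤ edgesL (t ∷ ts)
edgesL-tail t ts = m≤n⇒m≤1+n (m≤n+m (edgesL ts) (edges t))

edges-lookup< : ∀ ts (i : Fin (length ts)) → edges (lookup ts i) < edgesL ts
edges-lookup< (t ∷ ts) zero    = s≤s (m≤m+n (edges t) (edgesL ts))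
edges-lookup< (t ∷ ts) (suc i) = ≤-trans (edges-lookup< ts i) (edgesL-tail t ts)

edges-lookup-pair : ∀ ts (i j : Fin (length ts)) → i ≢ j →
                    suc (suc (edges (lookup ts i) + edges (lookup ts j))) ≤ edgesL ts
edges-lookup-pair (t ∷ ts) zero    zero    i≢j = ⊥-elim (i≢j refl)
edges-lookup-pair (t ∷ ts) zero    (suc j) _   =
  s≤s (subst (_≤ edges t + edgesL ts) (+-suc (edges t) _)
             (+-monoʳ-≤ (edges t) (edges-lookup< ts j)))
edges-lookup-pair (t ∷ ts) (suc i) zero    i≢j =
  subst (λ k → suc (suc k) ≤ edgesL (t ∷ ts)) (+-comm (edges t) _)
        (edges-lookup-pair (t ∷ ts) zero (suc i) (i≢j ∘ sym))
edges-lookup-pair (t ∷ ts) (suc i) (suc j) i≢j =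
  ≤-trans (edges-lookup-pair ts i j (i≢j ∘ cong suc)) (edgesL-tail t ts)

edges-branch≤ : ∀ {t} (e : Edge t) → edges (branch e) ≤ edges t
edges-branch≤ {node ts} (here i)    = <⇒≤ (edges-lookup< ts i)
edges-branch≤ {node ts} (there i e) = ≤-trans (edges-branch≤ e) (<⇒≤ (edges-lookup< ts i))

heaviest : (t : Tree) (ts : List Tree) → Fin (length (t ∷ ts))
heaviest t []       = zero
heaviest t (u ∷ us) with edges t ≤? edges (lookup (u ∷ us) (heaviest u us))
... | yes _ = suc (heaviest u us)
... | no  _ = zero

heaviest-max : ∀ t ts i → edges (lookup (t ∷ ts) i) ≤ edges (lookup (t ∷ ts) (heaviest t ts))
heaviest-max t []       zero = ≤-refl
heaviest-max t (u ∷ us) i with edges t ≤? edges (lookup (u ∷ us) (heaviest u us))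
heaviest-max t (u ∷ us) zero    | yes t≤ = t≤
heaviest-max t (u ∷ us) (suc i) | yes _  = heaviest-max u us i
heaviest-max t (u ∷ us) zero    | no  _  = ≤-refl
heaviest-max t (u ∷ us) (suc i) | no  t≰ = ≤-trans (heaviest-max u us i) (<⇒≤ (≰⇒> t≰))

mutual
  heavyPath : (t : Tree) → Path t
  heavyPath (node [])       = stop
  heavyPath (node (t ∷ ts)) = down (heaviest t ts) (heavyPathAt (t ∷ ts) (heaviest t ts))

  heavyPathAt : (ts : List Tree) (i : Fin (length ts)) → Path (lookup ts i)
  heavyPathAt (t ∷ ts) zero    = heavyPath t
  heavyPathAt (t ∷ ts) (suc i) = heavyPathAt ts i

-- The bound is relative to an arbitrary m ≥ |E(t)|, so that it survives
-- the descent into subtrees; IsMainStem t is the case m = edges t.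
SmallOffPath : ℕ → (t : Tree) → Path t → Set
SmallOffPath m t P = ∀ e → ¬ InPath P e → edges (branch e) < m / 2

down-heaviest-small : ∀ {m ts} j (p : Path (lookup ts j)) →
                      (∀ i → edges (lookup ts i) ≤ edges (lookup ts j)) → edgesL ts ≤ m →
                      SmallOffPath m (lookup ts j) p → SmallOffPath m (node ts) (down j p)
down-heaviest-small {m} {ts} j p heaviest≥ le small = small′
  where
  sibling-small : ∀ i → j ≢ i → edges (lookup ts i) < m / 2
  sibling-small i j≢i =
    smaller<half (heaviest≥ i) (≤-trans (edges-lookup-pair ts i j (j≢i ∘ sym)) le)

  small′ : SmallOffPath m (node ts) (down j p)
  small′ (here i) j≢i = sibling-small i j≢i
  small′ (there i e) e∉P with j ≟ i
  ... | yes refl = small e e∉P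
  ... | no  j≢i  = ≤-<-trans (edges-branch≤ e) (sibling-small i j≢i)

mutual
  heavyPath-small : ∀ {m} t → edges t ≤ m → SmallOffPath m t (heavyPath t)
  heavyPath-small (node [])       _  = λ { (here ()) ; (there () _) }
  heavyPath-small (node (t ∷ ts)) le =
    down-heaviest-small j (heavyPathAt (t ∷ ts) j) (heaviest-max t ts) le
      (heavyPathAt-small (t ∷ ts) j (≤-trans (<⇒≤ (edges-lookup< (t ∷ ts) j)) le))
    where j = heaviest t ts

  heavyPathAt-small : ∀ {m} ts i → edges (lookup ts i) ≤ m →
                      SmallOffPath m (lookup ts i) (heavyPathAt ts i)
  heavyPathAt-small (t ∷ ts) zero    = heavyPath-small t
  heavyPathAt-small (t ∷ ts) (suc i) = heavyPathAt-small ts i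

lemma3 : (T : Tree) → MainStem T
lemma3 T = heavyPath T , heavyPath-small T ≤-refl
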